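{- Let $G$ be a simple undirected graph with $n\ge 3$ vertices. Then $G$ is Hamiltonian if and only if for every coding sequence $\beta(G,n)$ of $G$ there exists $S=\{e_1,e_2,\ldots,e_n\}\subseteq\beta(G,n)$ ($n$ distinct elements) such that $S$ is reduced and $e_1+e_2+\cdots+e_n=\mathbf{0}$.
   Context: Coding sequences: for a simple graph $G=(V,E)$ with $n$ vertices, choose a labeling $V=\{v_0,\ldots,v_{n-1}\}$. For an edge $e=v_iv_j$ with $i>j$ let $f^\#(e)=(x_1,\ldots,x_{n-1})\in\mathbb{Z}_2^{n-1}$ with $x_k=1$ iff $n-i\le k\le n-j-1$ and $x_k=0$ otherwise. The coding sequence $\beta(G,n)$ for that labeling is $\{f^\#(e):e\in E\}$. A non-empty set $S$ of non-zero vectors of $\mathbb{Z}_2^{n-1}$ is reduced if $\sum_{e\in A}e\neq\mathbf{0}$ for every non-empty proper subset $A\subsetneq S$. -}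

module Defs where

open import Data.Nat using (ℕ; zero; suc; _∸_; _<_; _≤ᵇ_)
open import Data.Bool using (Bool; true; false; _∧_; _xor_; if_then_else_)
open import Data.Fin using (Fin; toℕ) renaming (zero to fzero; suc to fsuc)
open import Data.Fin.Subset using (Subset; Nonempty; ⊤)
open import Data.Vec using (Vec; []; _∷_; tabulate; replicate; zipWith)
open import Data.Product using (Σ; ∃; _×_; _,_)
open import Data.Sum using (_⊎_)
open import Relation.Binary.PropositionalEquality using (_≡_; _≢_)
open import Relation.Nullary using (¬_)
open import Function.Definitions using (Injective)
open import Level using (0ℓ)

record SimpleGraph (n : ℕ) : Set₁ where
  field
    Adj     : Fin n → Fin n → Set
    sym     : ∀ {u v} → Adj u v → Adj v u
    irrefl  : ∀ {v} → ¬ Adj v v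
open SimpleGraph public

-- Hamiltonian: there is a cyclic ordering π 0, π 1, …, π (n-1) of all
-- vertices (π injective, hence a bijection) with consecutive vertices
-- (cyclically) adjacent.
Hamiltonian : ∀ {n} → SimpleGraph n → Set
Hamiltonian {n} G =
  Σ (Fin n → Fin n) λ π → Injective _≡_ _≡_ π ×
    (∀ (i j : Fin n) →
      (toℕ j ≡ suc (toℕ i) ⊎ (toℕ i ≡ n ∸ 1 × toℕ j ≡ 0)) →
      Adj G (π i) (π j))

-- Vectors of Z₂^{n-1}; the position t : Fin (n ∸ 1) stands for the
-- coordinate x_k with k = t + 1.
Z2Vec : ℕ → Set
Z2Vec d = Vec Bool d

zeroVec : ∀ {d} → Z2Vec d
zeroVec = replicate _ false

_⊕_ : ∀ {d} → Z2Vec d → Z2Vec d → Z2Vec d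
_⊕_ = zipWith _xor_

-- f#(v_i v_j) for i > j : x_k = 1 iff n - i ≤ k ≤ n - j - 1.
fSharp : (n : ℕ) → Fin n → Fin n → Z2Vec (n ∸ 1)
fSharp n i j = tabulate λ t →
  let k = suc (toℕ t) in ((n ∸ toℕ i) ≤ᵇ k) ∧ (k ≤ᵇ (n ∸ toℕ j ∸ 1))

-- Labeling σ : v_i = σ i (σ a bijection Fin n → Fin n, given as an injection).
-- Membership in the coding sequence β(G,n) for the labeling σ.
InCoding : ∀ {n} → SimpleGraph n → (Fin n → Fin n) → Z2Vec (n ∸ 1) → Set
InCoding {n} G σ v =
  ∃ λ (i : Fin n) → ∃ λ (j : Fin n) →
    toℕ j < toℕ i × Adj G (σ i) (σ j) × fSharp n i j ≡ v

sumSub : ∀ {m d} → Subset m → (Fin m → Z2Vec d) → Z2Vec d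
sumSub [] S = zeroVec
sumSub (b ∷ A) S =
  if b then S fzero ⊕ sumSub A (λ x → S (fsuc x)) else sumSub A (λ x → S (fsuc x))

-- A set of vectors given by an injective (distinct-elements) family S
-- indexed by Fin m is reduced: m ≥ 1 (non-empty), all members non-zero,
-- and every non-empty proper sub-family has non-zero sum.
Reduced : ∀ {m d} → (Fin m → Z2Vec d) → Set
Reduced {m} S =
  (0 < m) ×
  (∀ x → S x ≢ zeroVec) ×
  (∀ (A : Subset m) → Nonempty A → A ≢ ⊤ → sumSub A S ≢ zeroVec)

module Submission where

-- The code of an edge v_i v_j (i > j) is a boundary: its coordinate at the threshold c = n-1-k is
-- [i < c] + [j < c].  So the codes of an edge set A sum to Φ(deg_A), where deg_A u is the parity
-- of the A-degree of u and Φ p lists the parities of p below each threshold.  Since deg_A has even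
-- total (handshake), Φ is injective on it:  Σ_{e∈A} f#(e) = 0  ⇔  all A-degrees are even.
-- Forward: a Hamiltonian cycle has even degrees, while a non-empty proper set of its edges has an
-- edge whose successor is missing, leaving an odd vertex; reducedness then also makes the codes
-- non-zero and distinct (n ≥ 3).  Backward (identity labeling): the n edges have even degrees, so
-- a walk never reusing the edge just traversed exists; its first return closes a cycle with even
-- degrees, hence zero sum; by reducedness it uses all n edges, so it is Hamiltonian.

open import Defs hiding (sym)
open import Data.Nat using (ℕ; zero; suc; _≤_; _<_; _∸_; _+_; z≤n; s≤s; _≤ᵇ_; _<ᵇ_; _≤?_; _<?_)
open import Data.Nat.Properties
  using ( ≤-trans; <-trans; ≤-<-trans; <⇒≤; ≤-antisym; ≤-pred; n≤1+n; n<1+n; <-irrefl; n≮n; 1+n≰n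
        ; 1+n≢n; 1+n≢0; <⇒≢; ≤⇒≯; ≮⇒≥; ≰⇒>; <⇒≱; <-cmp; suc-injective; m≤n⇒m<n∨m≡n; +-comm; +-suc
        ; +-identityʳ; +-monoʳ-≤; +-monoʳ-<; +-cancelˡ-≡; m≤n+m∸n; m≤n+o⇒m∸n≤o; ∸-+-assoc
        ; ∸-monoʳ-<; m∸[m∸n]≡n; m<n⇒0<n∸m; m+[n∸m]≡n; <⇒<ᵇ; <ᵇ⇒<; module ≤-Reasoning )
open import Data.Bool using (Bool; true; false; not; _∧_; _xor_; T; if_then_else_)
import Data.Bool as Bool
open import Data.Bool.Properties
  using ( xor-∧-commutativeRing; xor-same; xor-identityʳ; xor-assoc; xor-comm; ∧-identityʳ; ∧-zeroʳ
        ; ∧-comm; ∧-assoc; ∧-distribˡ-xor; ∧-distribʳ-xor; T-≡ )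
open import Algebra.Bundles using (CommutativeRing)
open import Data.Fin using (Fin; toℕ; fromℕ<; punchOut) renaming (zero to fzero; suc to fsuc)
open import Data.Fin.Properties
  using (_≟_; toℕ<n; toℕ-fromℕ<; fromℕ<-toℕ; toℕ-injective; any?; injective⇒≤; punchOut-injective)
open import Data.Fin.Subset using (Subset; Nonempty; ⊤)
open import Data.Vec using ([]; _∷_; lookup; tabulate)
open import Data.Vec.Properties
  using ( lookup∘tabulate; tabulate∘lookup; tabulate-cong; lookup-replicate; lookup-zipWith
        ; lookup⇒[]=; []=⇒lookup )
open import Data.Product using (Σ; ∃; _×_; _,_; proj₁; proj₂)
open import Data.Sum using (_⊎_; inj₁; inj₂)
open import Data.Unit using (tt)
open import Data.Empty using (⊥; ⊥-elim)
open import Function.Definitions using (Injective)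
open import Function.Bundles using (_⇔_; mk⇔; Equivalence)
open import Relation.Binary using (tri<; tri≈; tri>)
open import Relation.Nullary using (does; ¬?; yes; no; _×-dec_)
open import Relation.Nullary.Decidable using (dec-true; dec-false; does-⇔)
open import Relation.Binary.PropositionalEquality
  using (_≡_; _≢_; refl; sym; trans; cong; cong₂; subst; subst₂; module ≡-Reasoning)

open import Algebra.Properties.Semiring.Sum (CommutativeRing.semiring xor-∧-commutativeRing)
  using (sum; sum-syntax; sum-cong-≗; sum-replicate-zero; ∑-distrib-+; ∑-comm; *-distribˡ-sum; *-distribʳ-sum)

true≢false : true ≢ false
true≢false ()

δ : ∀ {n} → Fin n → Fin n → Bool
δ x y = does (x ≟ y)

δ-refl : ∀ {n} (x : Fin n) → δ x x ≡ true
δ-refl x = dec-true (x ≟ x) refl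

δ-≢ : ∀ {n} {x y : Fin n} → x ≢ y → δ x y ≡ false
δ-≢ {x = x} {y} = dec-false (x ≟ y)

δ-sym : ∀ {n} (x y : Fin n) → δ x y ≡ δ y x
δ-sym x y = does-⇔ (mk⇔ sym sym) (x ≟ y) (y ≟ x)

δ-true⇒≡ : ∀ {n} {x y : Fin n} → δ x y ≡ true → x ≡ y
δ-true⇒≡ {x = x} {y} e with x ≟ y | e
... | yes x≡y | _ = x≡y
... | no _    | ()

δ-injective : ∀ {m n} (ν : Fin m → Fin n) → Injective _≡_ _≡_ ν → ∀ x y → δ (ν x) (ν y) ≡ δ x y
δ-injective ν ν-inj x y = does-⇔ (mk⇔ ν-inj (cong ν)) (ν x ≟ ν y) (x ≟ y)

∑-false : ∀ {n} (f : Fin n → Bool) → (∀ x → f x ≡ false) → ∑[ x < n ] f x ≡ false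
∑-false {n} f vanish = trans (sum-cong-≗ vanish) (sum-replicate-zero n)

∑-select : ∀ {n} (f : Fin n → Bool) (y : Fin n) → ∑[ x < n ] (f x ∧ δ x y) ≡ f y
∑-select {suc n} f fzero = begin
    (f fzero ∧ true) xor ∑[ x < n ] (f (fsuc x) ∧ false)
  ≡⟨ cong₂ _xor_ (∧-identityʳ (f fzero))
                 (∑-false (λ x → f (fsuc x) ∧ false) (λ x → ∧-zeroʳ (f (fsuc x)))) ⟩
    f fzero xor false
  ≡⟨ xor-identityʳ (f fzero) ⟩
    f fzero
  ∎ where open ≡-Reasoning
∑-select {suc n} f (fsuc y) = begin
    (f fzero ∧ false) xor ∑[ x < n ] (f (fsuc x) ∧ δ x y)
  ≡⟨ cong₂ _xor_ (∧-zeroʳ (f fzero)) (∑-select (λ x → f (fsuc x)) y) ⟩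
    f (fsuc y)
  ∎ where open ≡-Reasoning

∑-select₂ : ∀ {n} (f : Fin n → Bool) y z → ∑[ x < n ] (f x ∧ (δ x y xor δ x z)) ≡ f y xor f z
∑-select₂ {n} f y z = begin
    ∑[ x < n ] (f x ∧ (δ x y xor δ x z))
  ≡⟨ sum-cong-≗ (λ x → ∧-distribˡ-xor (f x) (δ x y) (δ x z)) ⟩
    ∑[ x < n ] ((f x ∧ δ x y) xor (f x ∧ δ x z))
  ≡⟨ ∑-distrib-+ (λ x → f x ∧ δ x y) (λ x → f x ∧ δ x z) ⟩
    ∑[ x < n ] (f x ∧ δ x y) xor ∑[ x < n ] (f x ∧ δ x z)
  ≡⟨ cong₂ _xor_ (∑-select f y) (∑-select f z) ⟩
    f y xor f z
  ∎ where open ≡-Reasoning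

∑-true⇒∃ : ∀ {n} (f : Fin n → Bool) → ∑[ x < n ] f x ≡ true → ∃ λ x → f x ≡ true
∑-true⇒∃ {suc n} f odd with f fzero in f0
... | true  = fzero , f0
... | false = let (x , fx) = ∑-true⇒∃ (λ x → f (fsuc x)) odd in fsuc x , fx

∧-not-true : ∀ {a b} → a ∧ not b ≡ true → a ≡ true × b ≡ false
∧-not-true {true} {false} _ = refl , refl

-- In an even sum, every true summand has a partner: the parity form of "even degree ≥ 2".
∑-other : ∀ {n} (f : Fin n → Bool) (y : Fin n) → ∑[ x < n ] f x ≡ false → f y ≡ true →
  ∃ λ x → x ≢ y × f x ≡ true
∑-other {n} f y even fy with ∑-true⇒∃ (λ x → f x ∧ not (δ x y)) others-odd
  where
  others-odd : ∑[ x < n ] (f x ∧ not (δ x y)) ≡ true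
  others-odd = begin
      ∑[ x < n ] (f x ∧ (true xor δ x y))
    ≡⟨ sum-cong-≗ (λ x → ∧-distribˡ-xor (f x) true (δ x y)) ⟩
      ∑[ x < n ] ((f x ∧ true) xor (f x ∧ δ x y))
    ≡⟨ ∑-distrib-+ (λ x → f x ∧ true) (λ x → f x ∧ δ x y) ⟩
      ∑[ x < n ] (f x ∧ true) xor ∑[ x < n ] (f x ∧ δ x y)
    ≡⟨ cong₂ _xor_ (trans (sum-cong-≗ (λ x → ∧-identityʳ (f x))) even) (trans (∑-select f y) fy) ⟩
      true
    ∎ where open ≡-Reasoning
... | x , partner with ∧-not-true partner
... | fx , x≢y = x , (λ { refl → true≢false (trans (sym (δ-refl x)) x≢y) }) , fx

∑-telescope : ∀ {n} (h : ℕ → Bool) → ∑[ k < n ] (h (toℕ k) xor h (suc (toℕ k))) ≡ h 0 xor h n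
∑-telescope {zero} h = sym (xor-same (h 0))
∑-telescope {suc n} h = begin
    (h 0 xor h 1) xor ∑[ k < n ] (h (suc (toℕ k)) xor h (suc (suc (toℕ k))))
  ≡⟨ cong ((h 0 xor h 1) xor_) (∑-telescope {n} (λ k → h (suc k))) ⟩
    (h 0 xor h 1) xor (h 1 xor h (suc n))
  ≡⟨ xor-assoc (h 0) (h 1) _ ⟩
    h 0 xor (h 1 xor (h 1 xor h (suc n)))
  ≡⟨ cong (h 0 xor_) (sym (xor-assoc (h 1) (h 1) _)) ⟩
    h 0 xor ((h 1 xor h 1) xor h (suc n))
  ≡⟨ cong (λ b → h 0 xor (b xor h (suc n))) (xor-same (h 1)) ⟩
    h 0 xor h (suc n)
  ∎ where open ≡-Reasoning

∑-swap-scaled : ∀ {m n} (x : Fin m → Bool) (y : Fin n → Bool) (f : Fin m → Fin n → Bool) →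
  ∑[ e < m ] (x e ∧ ∑[ u < n ] (y u ∧ f e u)) ≡ ∑[ u < n ] (y u ∧ ∑[ e < m ] (x e ∧ f e u))
∑-swap-scaled {m} {n} x y f = begin
    ∑[ e < m ] (x e ∧ ∑[ u < n ] (y u ∧ f e u))
  ≡⟨ sum-cong-≗ (λ e → *-distribˡ-sum (x e) (λ u → y u ∧ f e u)) ⟩
    ∑[ e < m ] ∑[ u < n ] (x e ∧ (y u ∧ f e u))
  ≡⟨ sum-cong-≗ (λ e → sum-cong-≗ (λ u → ∧-exchange (x e) (y u) (f e u))) ⟩
    ∑[ e < m ] ∑[ u < n ] (y u ∧ (x e ∧ f e u))
  ≡⟨ ∑-comm (λ e u → y u ∧ (x e ∧ f e u)) ⟩
    ∑[ u < n ] ∑[ e < m ] (y u ∧ (x e ∧ f e u))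
  ≡⟨ sum-cong-≗ (λ u → sym (*-distribˡ-sum (y u) (λ e → x e ∧ f e u))) ⟩
    ∑[ u < n ] (y u ∧ ∑[ e < m ] (x e ∧ f e u))
  ∎
  where
  open ≡-Reasoning
  ∧-exchange : ∀ a b c → a ∧ (b ∧ c) ≡ b ∧ (a ∧ c)
  ∧-exchange a b c = trans (sym (∧-assoc a b c)) (trans (cong (_∧ c) (∧-comm a b)) (∧-assoc b a c))

vec-ext : ∀ {d} {u v : Z2Vec d} → (∀ t → lookup u t ≡ lookup v t) → u ≡ v
vec-ext {u = u} {v} pointwise = begin
    u                   ≡⟨ sym (tabulate∘lookup u) ⟩
    tabulate (lookup u) ≡⟨ tabulate-cong pointwise ⟩
    tabulate (lookup v) ≡⟨ tabulate∘lookup v ⟩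
    v                   ∎ where open ≡-Reasoning

lookup-zeroVec : ∀ {d} (t : Fin d) → lookup (zeroVec {d}) t ≡ false
lookup-zeroVec t = lookup-replicate t false

lookup-sumSub : ∀ {m d} (A : Subset m) (S : Fin m → Z2Vec d) (t : Fin d) →
  lookup (sumSub A S) t ≡ ∑[ x < m ] (lookup A x ∧ lookup (S x) t)
lookup-sumSub [] S t = lookup-zeroVec t
lookup-sumSub (true ∷ A) S t = trans (lookup-zipWith _xor_ t (S fzero) (sumSub A (λ x → S (fsuc x))))
  (cong (lookup (S fzero) t xor_) (lookup-sumSub A (λ x → S (fsuc x)) t))
lookup-sumSub (false ∷ A) S t = lookup-sumSub A (λ x → S (fsuc x)) t

sumSub-cong : ∀ {m d} (A : Subset m) {S S' : Fin m → Z2Vec d} → (∀ x → S x ≡ S' x) →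
  sumSub A S ≡ sumSub A S'
sumSub-cong {m} A {S} {S'} S≗S' = vec-ext λ t → begin
    lookup (sumSub A S) t                     ≡⟨ lookup-sumSub A S t ⟩
    ∑[ x < m ] (lookup A x ∧ lookup (S x) t)  ≡⟨ sum-cong-≗ (λ x → cong (λ v → lookup A x ∧ lookup v t)
                                                                        (S≗S' x)) ⟩
    ∑[ x < m ] (lookup A x ∧ lookup (S' x) t) ≡⟨ sym (lookup-sumSub A S' t) ⟩
    lookup (sumSub A S') t                    ∎ where open ≡-Reasoning

∸-swap-≤ : ∀ m n o → m ∸ n ≤ o → m ∸ o ≤ n
∸-swap-≤ m n o m∸n≤o = m≤n+o⇒m∸n≤o m o (begin
    m           ≤⟨ m≤n+m∸n m n ⟩
    n + (m ∸ n) ≤⟨ +-monoʳ-≤ n m∸n≤o ⟩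
    n + o       ≡⟨ +-comm n o ⟩
    o + n       ∎)
  where open ≤-Reasoning

∸-swap-< : ∀ m n o → n < m ∸ o → o < m ∸ n
∸-swap-< m n o n<m∸o = ≰⇒> (λ m∸n≤o → <⇒≱ n<m∸o (∸-swap-≤ m n o m∸n≤o))

-- The two ends of the interval n-i ≤ k ≤ n-j-1 defining f#, read off at the threshold c = d - t
-- (here n = d+1 and k = t+1): the lower end says i ≥ c, the upper end says j < c.
lower-end : ∀ d t i → (suc d ∸ i ≤ᵇ suc t) ≡ not (i <ᵇ d ∸ t)
lower-end d t i = does-⇔ (mk⇔ (λ le → ≤⇒≯ (∸-swap-≤ (suc d) i (suc t) le))
                               (λ i≮c → ∸-swap-≤ (suc d) (suc t) i (≮⇒≥ i≮c)))
                         (suc d ∸ i ≤? suc t) (¬? (i <? d ∸ t))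

upper-end : ∀ d t j → (suc t ≤ᵇ suc d ∸ j ∸ 1) ≡ (j <ᵇ d ∸ t)
upper-end d t j = does-⇔ (mk⇔ (λ le → ∸-swap-< d t j (subst (suc t ≤_) drop-one le))
                               (λ j<c → subst (suc t ≤_) (sym drop-one) (∸-swap-< d j t j<c)))
                         (suc t ≤? suc d ∸ j ∸ 1) (j <? d ∸ t)
  where
  drop-one : suc d ∸ j ∸ 1 ≡ d ∸ j
  drop-one = trans (∸-+-assoc (suc d) j 1) (cong (suc d ∸_) (+-comm j 1))

interval-xor : ∀ {x y} → (T x → T y) → not x ∧ y ≡ x xor y
interval-xor {false} _ = refl
interval-xor {true} {true} _ = refl
interval-xor {true} {false} x⇒y = ⊥-elim (x⇒y tt)

below : ∀ {n} → Fin n → ℕ → Bool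
below u c = toℕ u <ᵇ c

fSharp-coordinate : ∀ {d} (i j : Fin (suc d)) (t : Fin d) → toℕ j < toℕ i →
  lookup (fSharp (suc d) i j) t ≡ below i (d ∸ toℕ t) xor below j (d ∸ toℕ t)
fSharp-coordinate {d} i j t j<i = begin
    lookup (fSharp (suc d) i j) t
  ≡⟨ lookup∘tabulate _ t ⟩
    (suc d ∸ toℕ i ≤ᵇ suc (toℕ t)) ∧ (suc (toℕ t) ≤ᵇ suc d ∸ toℕ j ∸ 1)
  ≡⟨ cong₂ _∧_ (lower-end d (toℕ t) (toℕ i)) (upper-end d (toℕ t) (toℕ j)) ⟩
    not (below i c) ∧ below j c
  ≡⟨ interval-xor {below i c} {below j c} (λ i<c → <⇒<ᵇ (<-trans j<i (<ᵇ⇒< (toℕ i) c i<c))) ⟩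
    below i c xor below j c
  ∎
  where
  open ≡-Reasoning
  c = d ∸ toℕ t

prefix : ∀ {n} → (Fin n → Bool) → ℕ → Bool
prefix {n} p c = ∑[ u < n ] (below u c ∧ p u)

Φ : ∀ {d} → (Fin (suc d) → Bool) → Z2Vec d
Φ {d} p = tabulate λ t → prefix p (d ∸ toℕ t)

prefix-zero : ∀ {n} (p : Fin n → Bool) → prefix p 0 ≡ false
prefix-zero p = ∑-false (λ u → below u 0 ∧ p u) (λ _ → refl)

below-top : ∀ {n} (v : Fin n) → below v n ≡ true
below-top v = Equivalence.to T-≡ (<⇒<ᵇ (toℕ<n v))

prefix-xor : ∀ {n} (p q : Fin n → Bool) c → prefix (λ u → p u xor q u) c ≡ prefix p c xor prefix q c
prefix-xor p q c = trans (sum-cong-≗ (λ u → ∧-distribˡ-xor (below u c) (p u) (q u)))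
  (∑-distrib-+ (λ u → below u c ∧ p u) (λ u → below u c ∧ q u))

prefix-δ : ∀ {n} (v : Fin n) c → prefix (δ v) c ≡ below v c
prefix-δ v c = trans (sum-cong-≗ (λ u → cong (below u c ∧_) (δ-sym v u))) (∑-select (λ u → below u c) v)

below-step : ∀ {n} (w u : Fin n) → below w (suc (toℕ u)) xor below w (toℕ u) ≡ δ w u
below-step fzero fzero = refl
below-step fzero (fsuc u) = refl
below-step (fsuc w) fzero = refl
below-step (fsuc w) (fsuc u) = below-step w u

-- Consecutive prefix parities differ by one point of p, so the prefixes determine p.
prefix-step : ∀ {n} (p : Fin n → Bool) (u : Fin n) → prefix p (suc (toℕ u)) xor prefix p (toℕ u) ≡ p u
prefix-step {n} p u = begin
    prefix p (suc (toℕ u)) xor prefix p (toℕ u)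
  ≡⟨ sym (∑-distrib-+ (λ w → below w (suc (toℕ u)) ∧ p w) (λ w → below w (toℕ u) ∧ p w)) ⟩
    ∑[ w < n ] ((below w (suc (toℕ u)) ∧ p w) xor (below w (toℕ u) ∧ p w))
  ≡⟨ sum-cong-≗ (λ w → sym (∧-distribʳ-xor (p w) (below w (suc (toℕ u))) (below w (toℕ u)))) ⟩
    ∑[ w < n ] ((below w (suc (toℕ u)) xor below w (toℕ u)) ∧ p w)
  ≡⟨ sum-cong-≗ (λ w → trans (cong (_∧ p w) (below-step w u)) (∧-comm (δ w u) (p w))) ⟩
    ∑[ w < n ] (p w ∧ δ w u)
  ≡⟨ ∑-select p u ⟩
    p u
  ∎ where open ≡-Reasoning

threshold : ∀ {d} c → 0 < c → c ≤ d → ∃ λ (t : Fin d) → d ∸ toℕ t ≡ c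
threshold {d} c 0<c c≤d = fromℕ< d∸c<d , trans (cong (d ∸_) (toℕ-fromℕ< d∸c<d)) (m∸[m∸n]≡n c≤d)
  where
  d∸c<d : d ∸ c < d
  d∸c<d = ∸-monoʳ-< 0<c c≤d

-- If Φ p = 0 and p has even size, all prefix parities vanish: Φ covers 1 ≤ c ≤ d, the rest is given.
prefixes-vanish : ∀ {d} (p : Fin (suc d) → Bool) → prefix p (suc d) ≡ false → Φ p ≡ zeroVec →
  ∀ c → c ≤ suc d → prefix p c ≡ false
prefixes-vanish p _ _ zero _ = prefix-zero p
prefixes-vanish {d} p top Φp≡0 (suc c) c≤ with suc c ≤? d
... | yes c≤d = let (t , d∸t≡c) = threshold (suc c) (s≤s z≤n) c≤d in begin
    prefix p (suc c)       ≡⟨ cong (prefix p) (sym d∸t≡c) ⟩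
    prefix p (d ∸ toℕ t)   ≡⟨ sym (lookup∘tabulate (λ t → prefix p (d ∸ toℕ t)) t) ⟩
    lookup (Φ p) t         ≡⟨ cong (λ v → lookup v t) Φp≡0 ⟩
    lookup (zeroVec {d}) t ≡⟨ lookup-zeroVec t ⟩
    false                  ∎
  where open ≡-Reasoning
... | no c≰d = trans (cong (prefix p) (≤-antisym c≤ (≰⇒> c≰d))) top

Φ-kernel : ∀ {d} (p : Fin (suc d) → Bool) → prefix p (suc d) ≡ false → Φ p ≡ zeroVec →
  ∀ u → p u ≡ false
Φ-kernel p top Φp≡0 u = begin
    p u                                         ≡⟨ sym (prefix-step p u) ⟩
    prefix p (suc (toℕ u)) xor prefix p (toℕ u) ≡⟨ cong₂ _xor_ (vanish (suc (toℕ u)) (toℕ<n u))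
                                                                (vanish (toℕ u) (<⇒≤ (toℕ<n u))) ⟩
    false                                       ∎
  where
  open ≡-Reasoning
  vanish = prefixes-vanish p top Φp≡0

Φ-vanishing : ∀ {d} (p : Fin (suc d) → Bool) → (∀ u → p u ≡ false) → Φ p ≡ zeroVec
Φ-vanishing {d} p p≡0 = vec-ext λ t → begin
    lookup (Φ p) t         ≡⟨ lookup∘tabulate (λ t → prefix p (d ∸ toℕ t)) t ⟩
    prefix p (d ∸ toℕ t)   ≡⟨ ∑-false (λ u → below u (d ∸ toℕ t) ∧ p u)
                                (λ u → trans (cong (below u (d ∸ toℕ t) ∧_) (p≡0 u)) (∧-zeroʳ _)) ⟩
    false                  ≡⟨ sym (lookup-zeroVec t) ⟩
    lookup (zeroVec {d}) t ∎
  where open ≡-Reasoning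

SameEnds : ∀ {n} → Fin n → Fin n → Fin n → Fin n → Set
SameEnds x y u v = (x ≡ u × y ≡ v) ⊎ (x ≡ v × y ≡ u)

same-ends-sym : ∀ {n} {x y u v : Fin n} → SameEnds x y u v → SameEnds u v x y
same-ends-sym (inj₁ (refl , refl)) = inj₁ (refl , refl)
same-ends-sym (inj₂ (refl , refl)) = inj₂ (refl , refl)

same-pair : ∀ {n} {x y u v u' v' : Fin n} → SameEnds x y u v → SameEnds x y u' v' →
  (u ≡ u' × v ≡ v') ⊎ (u ≡ v' × v ≡ u')
same-pair (inj₁ (refl , refl)) (inj₁ (refl , refl)) = inj₁ (refl , refl)
same-pair (inj₁ (refl , refl)) (inj₂ (refl , refl)) = inj₂ (refl , refl)
same-pair (inj₂ (refl , refl)) (inj₁ (refl , refl)) = inj₂ (refl , refl)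
same-pair (inj₂ (refl , refl)) (inj₂ (refl , refl)) = inj₁ (refl , refl)

δ-ends : ∀ {n} {x y u v : Fin n} → SameEnds x y u v → ∀ w → δ x w xor δ y w ≡ δ u w xor δ v w
δ-ends (inj₁ (refl , refl)) w = refl
δ-ends {x = x} {y} (inj₂ (refl , refl)) w = xor-comm (δ x w) (δ y w)

adj-ends : ∀ {n m} (G : SimpleGraph n) (f : Fin m → Fin n) {x y u v : Fin m} →
  SameEnds x y u v → Adj G (f u) (f v) → Adj G (f x) (f y)
adj-ends G f (inj₁ (refl , refl)) uv = uv
adj-ends G f (inj₂ (refl , refl)) uv = SimpleGraph.sym G uv

module EdgeFamily {d m : ℕ} (a b : Fin m → Fin (suc d)) (b<a : ∀ e → toℕ (b e) < toℕ (a e)) where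

  inc : Fin m → Fin (suc d) → Bool
  inc e u = δ (a e) u xor δ (b e) u

  degree : Subset m → Fin (suc d) → Bool
  degree A u = ∑[ e < m ] (lookup A e ∧ inc e u)

  code : Fin m → Z2Vec d
  code e = fSharp (suc d) (a e) (b e)

  prefix-inc : ∀ e c → prefix (inc e) c ≡ below (a e) c xor below (b e) c
  prefix-inc e c = trans (prefix-xor (δ (a e)) (δ (b e)) c) (cong₂ _xor_ (prefix-δ (a e) c) (prefix-δ (b e) c))

  code-coordinate : ∀ e t → lookup (code e) t ≡ prefix (inc e) (d ∸ toℕ t)
  code-coordinate e t = trans (fSharp-coordinate (a e) (b e) t (b<a e)) (sym (prefix-inc e (d ∸ toℕ t)))

  prefix-degree : ∀ A c → prefix (degree A) c ≡ ∑[ e < m ] (lookup A e ∧ prefix (inc e) c)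
  prefix-degree A c = sym (∑-swap-scaled (lookup A) (λ u → below u c) inc)

  sumSub-code : ∀ A → sumSub A code ≡ Φ (degree A)
  sumSub-code A = vec-ext λ t → begin
      lookup (sumSub A code) t
    ≡⟨ lookup-sumSub A code t ⟩
      ∑[ e < m ] (lookup A e ∧ lookup (code e) t)
    ≡⟨ sum-cong-≗ (λ e → cong (lookup A e ∧_) (code-coordinate e t)) ⟩
      ∑[ e < m ] (lookup A e ∧ prefix (inc e) (d ∸ toℕ t))
    ≡⟨ sym (prefix-degree A (d ∸ toℕ t)) ⟩
      prefix (degree A) (d ∸ toℕ t)
    ≡⟨ sym (lookup∘tabulate (λ t → prefix (degree A) (d ∸ toℕ t)) t) ⟩
      lookup (Φ (degree A)) t
    ∎ where open ≡-Reasoning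

  -- Handshake lemma: the degrees add up to an even number.
  handshake : ∀ A → prefix (degree A) (suc d) ≡ false
  handshake A = trans (prefix-degree A (suc d)) (∑-false _ λ e → begin
      lookup A e ∧ prefix (inc e) (suc d)
    ≡⟨ cong (lookup A e ∧_) (prefix-inc e (suc d)) ⟩
      lookup A e ∧ (below (a e) (suc d) xor below (b e) (suc d))
    ≡⟨ cong (lookup A e ∧_) (cong₂ _xor_ (below-top (a e)) (below-top (b e))) ⟩
      lookup A e ∧ false
    ≡⟨ ∧-zeroʳ (lookup A e) ⟩
      false
    ∎)
    where open ≡-Reasoning

  even⇒sum-zero : ∀ A → (∀ u → degree A u ≡ false) → sumSub A code ≡ zeroVec
  even⇒sum-zero A even = trans (sumSub-code A) (Φ-vanishing (degree A) even)

  sum-zero⇒even : ∀ A → sumSub A code ≡ zeroVec → ∀ u → degree A u ≡ false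
  sum-zero⇒even A sum≡0 = Φ-kernel (degree A) (handshake A) (trans (sym (sumSub-code A)) sum≡0)

  inc-ends : ∀ {e u v} → SameEnds (a e) (b e) u v → ∀ w → inc e w ≡ δ u w xor δ v w
  inc-ends ends = δ-ends ends

ProperSumsNonzero : ∀ {m d} → (Fin m → Z2Vec d) → Set
ProperSumsNonzero {m} S = ∀ (A : Subset m) → Nonempty A → A ≢ ⊤ → sumSub A S ≢ zeroVec

third-element : ∀ {m} → 3 ≤ m → (x y : Fin m) → ∃ λ z → z ≢ x × z ≢ y
third-element (s≤s (s≤s (s≤s _))) x y with fzero ≟ x | fzero ≟ y
... | no 0≢x | no 0≢y = fzero , 0≢x , 0≢y
... | yes refl | yes refl = fsuc fzero , (λ ()) , (λ ())
... | yes refl | no _ with fsuc fzero ≟ y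
...   | no 1≢y = fsuc fzero , (λ ()) , 1≢y
...   | yes refl = fsuc (fsuc fzero) , (λ ()) , (λ ())
third-element (s≤s (s≤s (s≤s _))) x y | no _ | yes refl with fsuc fzero ≟ x
...   | no 1≢x = fsuc fzero , 1≢x , (λ ())
...   | yes refl = fsuc (fsuc fzero) , (λ ()) , (λ ())

indicator-proper : ∀ {m} (f : Fin m → Bool) {x z} → f x ≡ true → f z ≡ false →
  Nonempty (tabulate f) × tabulate f ≢ ⊤
indicator-proper f {x} {z} fx fz =
  (x , lookup⇒[]= x (tabulate f) (trans (lookup∘tabulate f x) fx)) ,
  λ f≡⊤ → true≢false (begin
    true                  ≡⟨ sym (lookup-replicate z true) ⟩
    lookup ⊤ z            ≡⟨ cong (λ A → lookup A z) (sym f≡⊤) ⟩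
    lookup (tabulate f) z ≡⟨ lookup∘tabulate f z ⟩
    f z                   ≡⟨ fz ⟩
    false                 ∎)
  where open ≡-Reasoning

lookup-sumSub-indicator : ∀ {m d} (f : Fin m → Bool) (S : Fin m → Z2Vec d) t →
  lookup (sumSub (tabulate f) S) t ≡ ∑[ x < m ] (lookup (S x) t ∧ f x)
lookup-sumSub-indicator f S t = trans (lookup-sumSub (tabulate f) S t)
  (sum-cong-≗ λ x → trans (cong (_∧ _) (lookup∘tabulate f x)) (∧-comm (f x) _))

sumSub-singleton : ∀ {m d} (S : Fin m → Z2Vec d) x → sumSub (tabulate λ z → δ z x) S ≡ S x
sumSub-singleton S x = vec-ext λ t →
  trans (lookup-sumSub-indicator (λ z → δ z x) S t) (∑-select (λ z → lookup (S z) t) x)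

sumSub-pair-self : ∀ {m d} (S : Fin m → Z2Vec d) x y → S x ≡ S y →
  sumSub (tabulate λ z → δ z x xor δ z y) S ≡ zeroVec
sumSub-pair-self {m} S x y Sx≡Sy = vec-ext λ t → begin
    lookup (sumSub (tabulate λ z → δ z x xor δ z y) S) t
  ≡⟨ lookup-sumSub-indicator (λ z → δ z x xor δ z y) S t ⟩
    ∑[ z < m ] (lookup (S z) t ∧ (δ z x xor δ z y))
  ≡⟨ ∑-select₂ (λ z → lookup (S z) t) x y ⟩
    lookup (S x) t xor lookup (S y) t
  ≡⟨ cong (λ v → lookup v t xor lookup (S y) t) Sx≡Sy ⟩
    lookup (S y) t xor lookup (S y) t
  ≡⟨ xor-same (lookup (S y) t) ⟩
    false
  ≡⟨ sym (lookup-zeroVec t) ⟩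
    lookup zeroVec t
  ∎ where open ≡-Reasoning

-- With at least three members, the condition on proper subfamilies already forces the members to be
-- non-zero (test singletons) and pairwise distinct (test pairs).
proper⇒nonzero : ∀ {m d} {S : Fin m → Z2Vec d} → 3 ≤ m → ProperSumsNonzero S → ∀ x → S x ≢ zeroVec
proper⇒nonzero {S = S} 3≤m proper x Sx≡0 =
  let (z , z≢x , _) = third-element 3≤m x x
      (nonempty , ≢⊤) = indicator-proper (λ w → δ w x) {x} {z} (δ-refl x) (δ-≢ z≢x)
  in proper (tabulate λ w → δ w x) nonempty ≢⊤ (trans (sumSub-singleton S x) Sx≡0)

proper⇒injective : ∀ {m d} {S : Fin m → Z2Vec d} → 3 ≤ m → ProperSumsNonzero S → Injective _≡_ _≡_ S
proper⇒injective {S = S} 3≤m proper {x} {y} Sx≡Sy with x ≟ y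
... | yes x≡y = x≡y
... | no x≢y =
  let (z , z≢x , z≢y) = third-element 3≤m x y
      (nonempty , ≢⊤) = indicator-proper (λ w → δ w x xor δ w y) {x} {z}
                          (cong₂ _xor_ (δ-refl x) (δ-≢ x≢y)) (cong₂ _xor_ (δ-≢ z≢x) (δ-≢ z≢y))
  in ⊥-elim (proper (tabulate λ w → δ w x xor δ w y) nonempty ≢⊤ (sumSub-pair-self S x y Sx≡Sy))

proper⇒full : ∀ {m d} {S : Fin m → Z2Vec d} {A : Subset m} → ProperSumsNonzero S → Nonempty A →
  sumSub A S ≡ zeroVec → ∀ x → lookup A x ≡ true
proper⇒full {A = A} proper nonempty sum≡0 x with lookup A x Bool.≟ true
... | yes x∈A = x∈A
... | no x∉A = ⊥-elim (proper A nonempty A≢⊤ sum≡0)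
  where
  A≢⊤ : A ≢ ⊤
  A≢⊤ A≡⊤ = x∉A (trans (cong (λ B → lookup B x) A≡⊤) (lookup-replicate x true))

next : ∀ {n} → Fin (suc n) → Fin (suc n)
next {n} x with suc (toℕ x) <? suc n
... | yes x+1<N = fromℕ< x+1<N
... | no _ = fzero

-- next takes exactly the steps allowed between consecutive vertices of a Hamiltonian cycle.
next-step : ∀ {n} (x : Fin (suc n)) → toℕ (next x) ≡ suc (toℕ x) ⊎ (toℕ x ≡ n × toℕ (next x) ≡ 0)
next-step {n} x with suc (toℕ x) <? suc n
... | yes x+1<N = inj₁ (toℕ-fromℕ< x+1<N)
... | no x+1≮N = inj₂ (≤-antisym (≤-pred (toℕ<n x)) (≤-pred (≮⇒≥ x+1≮N)) , refl)

next-injective : ∀ {n} → Injective _≡_ _≡_ (next {n})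
next-injective {n} {x} {y} nx≡ny with next-step x | next-step y
... | inj₁ nx | inj₁ ny = toℕ-injective (suc-injective (trans (sym nx) (trans (cong toℕ nx≡ny) ny)))
... | inj₂ (x≡n , _) | inj₂ (y≡n , _) = toℕ-injective (trans x≡n (sym y≡n))
... | inj₁ nx | inj₂ (_ , ny) = ⊥-elim (1+n≢0 (trans (sym nx) (trans (cong toℕ nx≡ny) ny)))
... | inj₂ (_ , nx) | inj₁ ny = ⊥-elim (1+n≢0 (trans (sym ny) (trans (cong toℕ (sym nx≡ny)) nx)))

next-moves : ∀ {n} → 1 ≤ n → (x : Fin (suc n)) → next x ≢ x
next-moves {n} 1≤n x nx≡x with next-step x
... | inj₁ nx = 1+n≢n (trans (sym nx) (cong toℕ nx≡x))
... | inj₂ (x≡n , nx≡0) = <⇒≢ 1≤n (sym (trans (sym x≡n) (trans (cong toℕ (sym nx≡x)) nx≡0)))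

next-last : ∀ {n} → next (fromℕ< (n<1+n n)) ≡ fzero
next-last {n} with next-step (fromℕ< (n<1+n n))
... | inj₂ (_ , nx≡0) = toℕ-injective nx≡0
... | inj₁ nx = ⊥-elim (n≮n (suc n) (subst (_< suc n) (trans nx (cong suc (toℕ-fromℕ< (n<1+n n))))
                                         (toℕ<n (next (fromℕ< (n<1+n n))))))

next-fromℕ< : ∀ {n k} (k<N : k < suc n) (k+1<N : suc k < suc n) → next (fromℕ< k<N) ≡ fromℕ< k+1<N
next-fromℕ< {n} {k} k<N k+1<N with next-step (fromℕ< k<N)
... | inj₁ step = toℕ-injective (trans step (trans (cong suc (toℕ-fromℕ< k<N)) (sym (toℕ-fromℕ< k+1<N))))
... | inj₂ (last , _) = ⊥-elim (<-irrefl (trans (sym (toℕ-fromℕ< k<N)) last) (≤-pred k+1<N))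

Closed : ∀ {n} → Subset (suc n) → Set
Closed A = ∀ k → lookup A k ≡ true → lookup A (next k) ≡ true

climb : ∀ {n} (A : Subset (suc n)) → Closed A → ∀ {x} → lookup A x ≡ true →
  ∀ k (k<N : k < suc n) → toℕ x ≤ k → lookup A (fromℕ< k<N) ≡ true
climb A closed {x} x∈A k k<N x≤k with m≤n⇒m<n∨m≡n x≤k
... | inj₂ x≡k = subst (λ y → lookup A y ≡ true) (toℕ-injective (trans x≡k (sym (toℕ-fromℕ< k<N)))) x∈A
climb A closed x∈A (suc k) k+1<N x≤k | inj₁ x<k+1 =
  subst (λ y → lookup A y ≡ true) (next-fromℕ< k<N k+1<N) (closed _ (climb A closed x∈A k k<N (≤-pred x<k+1)))
  where
  k<N = <-trans (n<1+n k) k+1<N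

-- A non-empty closed subset is everything: climb to the last point, wrap to 0, climb again.
closed-full : ∀ {n} (A : Subset (suc n)) → Nonempty A → Closed A → ∀ y → lookup A y ≡ true
closed-full {n} A (x , x∈A) closed y =
  subst (λ z → lookup A z ≡ true) (fromℕ<-toℕ y (toℕ<n y)) (climb A closed zero∈A (toℕ y) (toℕ<n y) z≤n)
  where
  last∈A : lookup A (fromℕ< (n<1+n n)) ≡ true
  last∈A = climb A closed ([]=⇒lookup x∈A) n (n<1+n n) (≤-pred (toℕ<n x))
  zero∈A : lookup A fzero ≡ true
  zero∈A = subst (λ z → lookup A z ≡ true) next-last (closed _ last∈A)

exit-point : ∀ {n} (A : Subset (suc n)) → Nonempty A → A ≢ ⊤ →
  ∃ λ k → lookup A k ≡ true × lookup A (next k) ≡ false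
exit-point A nonempty A≢⊤ with any? (λ k → (lookup A k Bool.≟ true) ×-dec (lookup A (next k) Bool.≟ false))
... | yes exit = exit
... | no none =
  ⊥-elim (A≢⊤ (vec-ext λ x → trans (closed-full A nonempty closed x) (sym (lookup-replicate x true))))
  where
  closed : Closed A
  closed k k∈A with lookup A (next k) in e
  ... | true = refl
  ... | false = ⊥-elim (none (k , k∈A , e))

injective⇒surjective : ∀ {n} (ν : Fin n → Fin n) → Injective _≡_ _≡_ ν → ∀ y → ∃ λ x → ν x ≡ y
injective⇒surjective {suc n} ν ν-inj y with any? (λ x → ν x ≟ y)
... | yes hit = hit
... | no miss = ⊥-elim (1+n≰n (injective⇒≤ {f = skip-y} skip-y-inj))
  where
  ν≢y : ∀ x → y ≢ ν x
  ν≢y x y≡νx = miss (x , sym y≡νx)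
  skip-y : Fin (suc n) → Fin n
  skip-y x = punchOut (ν≢y x)
  skip-y-inj : Injective _≡_ _≡_ skip-y
  skip-y-inj e = ν-inj (punchOut-injective (ν≢y _) (ν≢y _) e)

∑-δ-permutation : ∀ {n} (ν : Fin n → Fin n) → Injective _≡_ _≡_ ν →
  ∀ u → ∑[ x < n ] δ (ν x) u ≡ true
∑-δ-permutation {n} ν ν-inj u with injective⇒surjective ν ν-inj u
... | y , refl = begin
    ∑[ x < n ] δ (ν x) (ν y)  ≡⟨ sum-cong-≗ (λ x → δ-injective ν ν-inj x y) ⟩
    ∑[ x < n ] (true ∧ δ x y) ≡⟨ ∑-select (λ _ → true) y ⟩
    true                      ∎ where open ≡-Reasoning

-- The pair {u, v} listed with its larger endpoint first, as f# requires.
record OrientedPair {n} (u v : Fin n) : Set where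
  field
    hi lo : Fin n
    lo<hi : toℕ lo < toℕ hi
    ends  : SameEnds hi lo u v

orient : ∀ {n} {u v : Fin n} → u ≢ v → OrientedPair u v
orient {u = u} {v} u≢v with <-cmp (toℕ v) (toℕ u)
... | tri< v<u _ _ = record { hi = u ; lo = v ; lo<hi = v<u ; ends = inj₁ (refl , refl) }
... | tri≈ _ v≡u _ = ⊥-elim (u≢v (toℕ-injective (sym v≡u)))
... | tri> _ _ u<v = record { hi = v ; lo = u ; lo<hi = u<v ; ends = inj₂ (refl , refl) }

module CycleCodes {n} (3≤N : 3 ≤ suc n) (τ : Fin (suc n) → Fin (suc n)) (τ-inj : Injective _≡_ _≡_ τ) where

  cycle-edge : ∀ x → OrientedPair (τ x) (τ (next x))
  cycle-edge x = orient (λ τx≡τnx → next-moves 1≤n x (sym (τ-inj τx≡τnx)))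
    where
    1≤n : 1 ≤ n
    1≤n = ≤-pred (≤-trans (s≤s (s≤s z≤n)) 3≤N)

  open OrientedPair

  open EdgeFamily (λ x → hi (cycle-edge x)) (λ x → lo (cycle-edge x)) (λ x → lo<hi (cycle-edge x)) public

  cycle-degree : ∀ A u → degree A u ≡ ∑[ x < suc n ] (lookup A x ∧ (δ (τ x) u xor δ (τ (next x)) u))
  cycle-degree A u = sum-cong-≗ (λ x → cong (lookup A x ∧_) (inc-ends (ends (cycle-edge x)) u))

  -- Every vertex meets exactly two cycle edges.
  cycle-even : ∀ u → degree ⊤ u ≡ false
  cycle-even u = begin
      degree ⊤ u
    ≡⟨ cycle-degree ⊤ u ⟩
      ∑[ x < suc n ] (lookup ⊤ x ∧ (δ (τ x) u xor δ (τ (next x)) u))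
    ≡⟨ sum-cong-≗ (λ x → cong (_∧ (δ (τ x) u xor δ (τ (next x)) u)) (lookup-replicate x true)) ⟩
      ∑[ x < suc n ] (δ (τ x) u xor δ (τ (next x)) u)
    ≡⟨ ∑-distrib-+ (λ x → δ (τ x) u) (λ x → δ (τ (next x)) u) ⟩
      ∑[ x < suc n ] δ (τ x) u xor ∑[ x < suc n ] δ (τ (next x)) u
    ≡⟨ cong₂ _xor_ (∑-δ-permutation τ τ-inj u)
                   (∑-δ-permutation (λ x → τ (next x)) (λ e → next-injective (τ-inj e)) u) ⟩
      false
    ∎ where open ≡-Reasoning

  -- At an exit point k of A, the vertex τ (next k) meets exactly one edge of A.
  exit-odd : ∀ A k → lookup A k ≡ true → lookup A (next k) ≡ false → degree A (τ (next k)) ≡ true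
  exit-odd A k k∈A next∉A = begin
      degree A (τ (next k))
    ≡⟨ cycle-degree A (τ (next k)) ⟩
      ∑[ x < suc n ] (lookup A x ∧ (δ (τ x) (τ (next k)) xor δ (τ (next x)) (τ (next k))))
    ≡⟨ sum-cong-≗ (λ x → cong (lookup A x ∧_)
         (cong₂ _xor_ (δ-injective τ τ-inj x (next k))
                      (δ-injective (λ z → τ (next z)) (λ e → next-injective (τ-inj e)) x k))) ⟩
      ∑[ x < suc n ] (lookup A x ∧ (δ x (next k) xor δ x k))
    ≡⟨ ∑-select₂ (lookup A) (next k) k ⟩
      lookup A (next k) xor lookup A k
    ≡⟨ cong₂ _xor_ next∉A k∈A ⟩
      true
    ∎ where open ≡-Reasoning

  -- every non-empty proper set of cycle edges has an odd vertex, hence a non-zero sum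
  cycle-proper : ProperSumsNonzero code
  cycle-proper A nonempty A≢⊤ sum≡0 with exit-point A nonempty A≢⊤
  ... | k , k∈A , next∉A =
    true≢false (trans (sym (exit-odd A k k∈A next∉A)) (sum-zero⇒even A sum≡0 (τ (next k))))

hamiltonian⇒codes : ∀ {n} → 3 ≤ suc n → (G : SimpleGraph (suc n)) → Hamiltonian G →
  (σ : Fin (suc n) → Fin (suc n)) → Injective _≡_ _≡_ σ →
  Σ (Fin (suc n) → Z2Vec n) λ S →
    Injective _≡_ _≡_ S × (∀ x → InCoding G σ (S x)) × Reduced S × sumSub ⊤ S ≡ zeroVec
hamiltonian⇒codes {n} 3≤N G (π , π-inj , hamiltonian) σ σ-inj =
  code , proper⇒injective 3≤N cycle-proper , in-coding ,
  (s≤s z≤n , proper⇒nonzero 3≤N cycle-proper , cycle-proper) , even⇒sum-zero ⊤ cycle-even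
  where
  -- the cycle read in labels: σ (τ x) = π x
  τ : Fin (suc n) → Fin (suc n)
  τ x = proj₁ (injective⇒surjective σ σ-inj (π x))
  στ≡π : ∀ x → σ (τ x) ≡ π x
  στ≡π x = proj₂ (injective⇒surjective σ σ-inj (π x))
  τ-inj : Injective _≡_ _≡_ τ
  τ-inj {x} {y} τx≡τy = π-inj (trans (sym (στ≡π x)) (trans (cong σ τx≡τy) (στ≡π y)))
  open CycleCodes 3≤N τ τ-inj
  open OrientedPair
  in-coding : ∀ x → InCoding G σ (code x)
  in-coding x = hi (cycle-edge x) , lo (cycle-edge x) , lo<hi (cycle-edge x) ,
    adj-ends G σ (ends (cycle-edge x))
      (subst₂ (Adj G) (sym (στ≡π x)) (sym (στ≡π (next x))) (hamiltonian x (next x) (next-step x))) ,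
    refl

InjectiveBelow : ∀ {N} → (ℕ → Fin N) → ℕ → Set
InjectiveBelow f m = ∀ {p q} → p < m → q < m → f p ≡ f q → p ≡ q

record Loop {N} (f : ℕ → Fin N) : Set where
  field
    start length : ℕ
    nontrivial   : 0 < length
    closes       : f (start + length) ≡ f start
    simple       : InjectiveBelow f (start + length)

extend-injective : ∀ {N} (f : ℕ → Fin N) {m} → InjectiveBelow f (suc m) →
  (∀ q → q ≤ m → f q ≢ f (suc m)) → InjectiveBelow f (suc (suc m))
extend-injective f {m} inj fresh {p} {q} p<m+2 q<m+2 fp≡fq
  with m≤n⇒m<n∨m≡n (≤-pred p<m+2) | m≤n⇒m<n∨m≡n (≤-pred q<m+2)
... | inj₁ p≤m | inj₁ q≤m = inj p≤m q≤m fp≡fq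
... | inj₂ refl | inj₂ refl = refl
... | inj₁ p≤m | inj₂ refl = ⊥-elim (fresh p (≤-pred p≤m) fp≡fq)
... | inj₂ refl | inj₁ q≤m = ⊥-elim (fresh q (≤-pred q≤m) (sym fp≡fq))

search-loop : ∀ {N} (f : ℕ → Fin N) m → InjectiveBelow f (suc m) ⊎ Loop f
search-loop f zero = inj₁ λ { (s≤s z≤n) (s≤s z≤n) _ → refl }
search-loop f (suc m) with search-loop f m
... | inj₂ loop = inj₂ loop
... | inj₁ inj with any? (λ (i : Fin (suc m)) → f (toℕ i) ≟ f (suc m))
...   | yes (i , repeat) = inj₂ record
        { start = toℕ i ; length = suc m ∸ toℕ i ; nontrivial = m<n⇒0<n∸m (toℕ<n i)
        ; closes = trans (cong f end≡) (sym repeat)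
        ; simple = λ {p} {q} p< q< → inj (subst (p <_) end≡ p<) (subst (q <_) end≡ q<) }
  where
  end≡ : toℕ i + (suc m ∸ toℕ i) ≡ suc m
  end≡ = m+[n∸m]≡n (<⇒≤ (toℕ<n i))
...   | no no-repeat = inj₁ (extend-injective f inj fresh)
  where
  fresh : ∀ q → q ≤ m → f q ≢ f (suc m)
  fresh q q≤m repeat = no-repeat (fromℕ< (s≤s q≤m) , trans (cong f (toℕ-fromℕ< (s≤s q≤m))) repeat)

-- Every sequence in a finite set has a first return, since N+1 values cannot be distinct.
first-loop : ∀ {N} (f : ℕ → Fin N) → Loop f
first-loop {N} f with search-loop f N
... | inj₂ loop = loop
... | inj₁ inj = ⊥-elim (1+n≰n (injective⇒≤ {f = λ (i : Fin (suc N)) → f (toℕ i)}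
                                  (λ e → toℕ-injective (inj (toℕ<n _) (toℕ<n _) e))))

module EvenFamily {d m : ℕ} (a b : Fin m → Fin (suc d)) (b<a : ∀ e → toℕ (b e) < toℕ (a e))
  (even : ∀ u → EdgeFamily.degree a b b<a ⊤ u ≡ false) where

  open EdgeFamily a b b<a

  a≢b : ∀ e → a e ≢ b e
  a≢b e a≡b = <-irrefl (cong toℕ (sym a≡b)) (b<a e)

  ends-inc : ∀ {e u v} → SameEnds (a e) (b e) u v → inc e v ≡ true
  ends-inc {e} (inj₁ (refl , refl)) = cong₂ _xor_ (δ-≢ (a≢b e)) (δ-refl (b e))
  ends-inc {e} (inj₂ (refl , refl)) = cong₂ _xor_ (δ-refl (a e)) (δ-≢ (λ b≡a → a≢b e (sym b≡a)))

  other-end : Fin m → Fin (suc d) → Fin (suc d)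
  other-end e u = if δ (a e) u then b e else a e

  other-end-ends : ∀ {e u} → inc e u ≡ true → SameEnds (a e) (b e) u (other-end e u)
  other-end-ends {e} {u} at with δ (a e) u in a≡u
  ... | true  = inj₁ (δ-true⇒≡ a≡u , refl)
  ... | false = inj₂ (refl , δ-true⇒≡ at)

  -- Even degree: an edge arriving at a vertex can leave it by a different edge.
  another-edge : ∀ e u → inc e u ≡ true → ∃ λ e' → e' ≢ e × inc e' u ≡ true
  another-edge e u at = ∑-other (λ e' → inc e' u) e
    (trans (sum-cong-≗ (λ e' → cong (_∧ inc e' u) (sym (lookup-replicate e' true)))) (even u)) at

  record Position : Set where
    field
      vertex : Fin (suc d)
      edge   : Fin m
      at     : inc edge vertex ≡ true

  open Position

  advance : Position → Position
  advance p = record { vertex = v ; edge = proj₁ turn ; at = proj₂ (proj₂ turn) }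
    where
    v = other-end (edge p) (vertex p)
    turn = another-edge (edge p) v (ends-inc (other-end-ends (at p)))

  module Walk (e₀ : Fin m) where

    position : ℕ → Position
    position zero = record { vertex = a e₀ ; edge = e₀ ; at = ends-inc {e₀} (inj₂ (refl , refl)) }
    position (suc k) = advance (position k)

    w : ℕ → Fin (suc d)
    w k = vertex (position k)

    ε : ℕ → Fin m
    ε k = edge (position k)

    walk-ends : ∀ k → SameEnds (a (ε k)) (b (ε k)) (w k) (w (suc k))
    walk-ends k = other-end-ends (at (position k))

    walk-turns : ∀ k → ε (suc k) ≢ ε k
    walk-turns k = proj₁ (proj₂ (another-edge (ε k) (w (suc k)) (ends-inc (walk-ends k))))

    module Cycle (loop : Loop w) where

      open Loop loop renaming (start to j; length to L)

      W : ℕ → Fin (suc d)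
      W k = w (j + k)

      E : Fin L → Fin m
      E k = ε (j + toℕ k)

      W-simple : ∀ {p q} → p < L → q < L → W p ≡ W q → p ≡ q
      W-simple {p} {q} p<L q<L Wp≡Wq = +-cancelˡ-≡ j p q (simple (+-monoʳ-< j p<L) (+-monoʳ-< j q<L) Wp≡Wq)

      W-closes : W L ≡ W 0
      W-closes = trans closes (cong w (sym (+-identityʳ j)))

      cycle-ends : ∀ k → SameEnds (a (ε (j + k))) (b (ε (j + k))) (W k) (W (suc k))
      cycle-ends k = subst (SameEnds _ _ (W k)) (cong w (sym (+-suc j k))) (walk-ends (j + k))

      -- Distinct vertices force distinct edges; a cycle of length 2 would reuse an edge at once.
      no-repeated-edge : ∀ {P Q} → P < Q → Q < L → ε (j + P) ≢ ε (j + Q)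
      no-repeated-edge {P} {Q} P<Q Q<L same
        with same-pair (cycle-ends P) (subst (λ e → SameEnds (a e) (b e) (W Q) (W (suc Q))) (sym same) (cycle-ends Q))
      ... | inj₁ (WP≡WQ , _) = <-irrefl (W-simple (<-trans P<Q Q<L) Q<L WP≡WQ) P<Q
      ... | inj₂ (WP≡WQ+1 , WP+1≡WQ) with suc Q <? L
      ...   | yes Q+1<L = <-irrefl (W-simple (<-trans P<Q Q<L) Q+1<L WP≡WQ+1) (≤-trans P<Q (n≤1+n Q))
      ...   | no Q+1≮L = two-edge-loop P≡0 P+1≡Q
        where
        P≡0 : P ≡ 0
        P≡0 = W-simple (<-trans P<Q Q<L) nontrivial
                (trans WP≡WQ+1 (trans (cong W (≤-antisym Q<L (≮⇒≥ Q+1≮L))) W-closes))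
        P+1≡Q : suc P ≡ Q
        P+1≡Q = W-simple (≤-<-trans P<Q Q<L) Q<L WP+1≡WQ
        two-edge-loop : P ≡ 0 → suc P ≡ Q → ⊥
        two-edge-loop refl refl =
          walk-turns j (trans (cong ε (+-comm 1 j)) (trans (sym same) (cong ε (+-identityʳ j))))

      E-injective : Injective _≡_ _≡_ E
      E-injective {p} {q} Ep≡Eq with <-cmp (toℕ p) (toℕ q)
      ... | tri< p<q _ _ = ⊥-elim (no-repeated-edge p<q (toℕ<n q) Ep≡Eq)
      ... | tri≈ _ p≡q _ = toℕ-injective p≡q
      ... | tri> _ _ q<p = ⊥-elim (no-repeated-edge q<p (toℕ<n p) (sym Ep≡Eq))

      -- the edge set of the cycle (each edge counted mod 2)
      C : Subset m
      C = tabulate λ e → ∑[ k < L ] δ (E k) e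

      lookup-C : ∀ e → lookup C e ≡ ∑[ k < L ] δ (E k) e
      lookup-C = lookup∘tabulate (λ e → ∑[ k < L ] δ (E k) e)

      -- A closed walk has even degrees: its incidences telescope.
      C-even : ∀ u → degree C u ≡ false
      C-even u = begin
          ∑[ e < m ] (lookup C e ∧ inc e u)
        ≡⟨ sum-cong-≗ (λ e → cong (_∧ inc e u) (lookup-C e)) ⟩
          ∑[ e < m ] (∑[ k < L ] δ (E k) e ∧ inc e u)
        ≡⟨ sum-cong-≗ (λ e → *-distribʳ-sum (inc e u) (λ k → δ (E k) e)) ⟩
          ∑[ e < m ] ∑[ k < L ] (δ (E k) e ∧ inc e u)
        ≡⟨ ∑-comm (λ e k → δ (E k) e ∧ inc e u) ⟩
          ∑[ k < L ] ∑[ e < m ] (δ (E k) e ∧ inc e u)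
        ≡⟨ sum-cong-≗ (λ k → trans (sum-cong-≗ (λ e → trans (cong (_∧ inc e u) (δ-sym (E k) e))
                                                              (∧-comm (δ e (E k)) (inc e u))))
                                   (∑-select (λ e → inc e u) (E k))) ⟩
          ∑[ k < L ] inc (E k) u
        ≡⟨ sum-cong-≗ (λ k → inc-ends {E k} (cycle-ends (toℕ k)) u) ⟩
          ∑[ k < L ] (δ (W (toℕ k)) u xor δ (W (suc (toℕ k))) u)
        ≡⟨ ∑-telescope (λ k → δ (W k) u) ⟩
          δ (W 0) u xor δ (W L) u
        ≡⟨ cong (λ v → δ (W 0) u xor δ v u) W-closes ⟩
          δ (W 0) u xor δ (W 0) u
        ≡⟨ xor-same (δ (W 0) u) ⟩
          false
        ∎ where open ≡-Reasoning

      C-nonempty : Nonempty C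
      C-nonempty = E k₀ , lookup⇒[]= (E k₀) C (begin
          lookup C (E k₀)            ≡⟨ lookup-C (E k₀) ⟩
          ∑[ k < L ] δ (E k) (E k₀)  ≡⟨ sum-cong-≗ (λ k → δ-injective E E-injective k k₀) ⟩
          ∑[ k < L ] (true ∧ δ k k₀) ≡⟨ ∑-select (λ _ → true) k₀ ⟩
          true                       ∎)
        where
        open ≡-Reasoning
        k₀ = fromℕ< nontrivial

      C-covered : ∀ e → lookup C e ≡ true → ∃ λ k → E k ≡ e
      C-covered e e∈C with ∑-true⇒∃ (λ k → δ (E k) e) (trans (sym (lookup-C e)) e∈C)
      ... | k , hit = k , δ-true⇒≡ hit

codes⇒hamiltonian : ∀ {n} (G : SimpleGraph (suc n)) (S : Fin (suc n) → Z2Vec n) →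
  (∀ e → InCoding G (λ v → v) (S e)) → Reduced S → sumSub ⊤ S ≡ zeroVec → Hamiltonian G
codes⇒hamiltonian {n} G S in-coding (_ , _ , proper) total = hamiltonian-cycle (first-loop w)
  where
  a b : Fin (suc n) → Fin (suc n)
  a e = proj₁ (in-coding e)
  b e = proj₁ (proj₂ (in-coding e))
  b<a : ∀ e → toℕ (b e) < toℕ (a e)
  b<a e = proj₁ (proj₂ (proj₂ (in-coding e)))
  adj : ∀ e → Adj G (a e) (b e)
  adj e = proj₁ (proj₂ (proj₂ (proj₂ (in-coding e))))

  open EdgeFamily a b b<a

  code≡S : ∀ e → code e ≡ S e
  code≡S e = proj₂ (proj₂ (proj₂ (proj₂ (in-coding e))))

  open EvenFamily a b b<a (sum-zero⇒even ⊤ (trans (sumSub-cong ⊤ code≡S) total))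
  open Walk fzero

  -- Any loop of the walk is a Hamiltonian cycle (the loop is kept abstract: it is never computed).
  hamiltonian-cycle : Loop w → Hamiltonian G
  hamiltonian-cycle loop = π , π-injective , π-adjacent
    where
    open Cycle loop
    open Loop loop using (length)

    -- the cycle's edge set has zero sum, so by reducedness it contains every edge
    C-full : ∀ e → lookup C e ≡ true
    C-full = proper⇒full proper C-nonempty (trans (sym (sumSub-cong C code≡S)) (even⇒sum-zero C C-even))

    -- the cycle has distinct vertices (length ≤ N) and uses all N edges (N ≤ length)
    length≡N : length ≡ suc n
    length≡N = ≤-antisym
      (injective⇒≤ {f = λ (k : Fin length) → W (toℕ k)}
                   λ e → toℕ-injective (W-simple (toℕ<n _) (toℕ<n _) e))
      (injective⇒≤ {f = position-of} position-injective)
      where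
      position-of : Fin (suc n) → Fin length
      position-of e = proj₁ (C-covered e (C-full e))
      position-injective : Injective _≡_ _≡_ position-of
      position-injective {e} {e'} same = trans (sym (proj₂ (C-covered e (C-full e))))
                                               (trans (cong E same) (proj₂ (C-covered e' (C-full e'))))

    π : Fin (suc n) → Fin (suc n)
    π x = W (toℕ x)

    π-injective : Injective _≡_ _≡_ π
    π-injective e = toℕ-injective (W-simple (within (toℕ<n _)) (within (toℕ<n _)) e)
      where
      within : ∀ {k} → k < suc n → k < length
      within = subst (_ <_) (sym length≡N)

    cycle-adjacent : ∀ k → Adj G (W k) (W (suc k))
    cycle-adjacent k = adj-ends G (λ v → v) (same-ends-sym (cycle-ends k)) (adj _)

    π-adjacent : ∀ (i j : Fin (suc n)) → (toℕ j ≡ suc (toℕ i) ⊎ (toℕ i ≡ n × toℕ j ≡ 0)) →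
      Adj G (π i) (π j)
    π-adjacent i j (inj₁ j≡i+1) = subst (λ k → Adj G (π i) (W k)) (sym j≡i+1) (cycle-adjacent (toℕ i))
    π-adjacent i j (inj₂ (i≡n , j≡0)) = subst₂ (λ k k' → Adj G (W k) (W k')) (sym i≡n) (sym j≡0)
      (subst (Adj G (W n)) (trans (cong W (sym length≡N)) W-closes) (cycle-adjacent n))

corollary1 : (n : ℕ) → 3 ≤ n → (G : SimpleGraph n) →
    Hamiltonian G ⇔
      ((σ : Fin n → Fin n) → Injective _≡_ _≡_ σ →
        Σ (Fin n → Z2Vec (n ∸ 1)) λ S →
          Injective _≡_ _≡_ S ×
          (∀ x → InCoding G σ (S x)) ×
          Reduced S ×
          sumSub ⊤ S ≡ zeroVec)
corollary1 (suc n) 3≤N G = mk⇔ (hamiltonian⇒codes 3≤N G) λ codes →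
  let (S , _ , in-coding , reduced , total) = codes (λ v → v) (λ e → e)
  in codes⇒hamiltonian G S in-coding reduced total
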